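{- Let $A, B$ be types in a univalent universe and let $f : A \to B$ be such that $\mathsf{ishadj}\, f$ is inhabited. Then there is an equivalence of types \[ \mathsf{2adj}\, f \simeq \prod_{x : A} \big(\mathsf{refl}_{\mathsf{refl}_x} = \mathsf{refl}_{\mathsf{refl}_x}\big). \]
   Context: Work in homotopy type theory with univalence and function extensionality. For $f : A \to B$, $f[p]$ denotes $\mathsf{ap}_f\, p$ and $f\llbracket \alpha \rrbracket$ the action of $f$ on a 2-path $\alpha$. $f \sim g$ is $\prod_x fx = gx$. For a homotopy $H : f \sim g$: $H_h :\equiv \lambda c.\,H_{hc}$; $k[H] :\equiv \lambda a.\,k[H_a]$; for $\alpha : H \sim H'$, $k\llbracket\alpha\rrbracket :\equiv \lambda a.\, k\llbracket \alpha_a\rrbracket$. $H \cdot H'$ is pointwise concatenation in diagrammatic order. For $h : X \to Y$, $k : Y \to X$, $H : kh \sim \mathsf{id}_X$, $\mathsf{Coh}\, H : H_{kh} \sim k[h[H]]$ has component at $x$ the naturality path $H_{khx} = (kh)[H_x]$ (naturality of $H$ at $H_x$, cancelling $H_x$) followed by the functoriality path $(kh)[H_x] = k[h[H_x]]$; $\mathsf{Coh}\,\mathsf{refl} \equiv \mathsf{refl}_{\mathsf{refl}}$. Definitions (with $g : B \to A$, $\eta : gf \sim \mathsf{id}_A$, $\varepsilon : fg \sim \mathsf{id}_B$): $\mathsf{ishadj}\, f :\equiv \sum_{g, \eta, \varepsilon} (f[\eta] \sim \varepsilon_f)$; $\mathsf{2adj}\, f :\equiv \sum_{g, \eta, \varepsilon}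 \sum_{\tau : f[\eta] \sim \varepsilon_f} \sum_{\theta : \eta_g \sim g[\varepsilon]} (\mathsf{Coh}\, \eta \cdot g\llbracket \tau \rrbracket \sim \theta_f) \times (\tau_g \cdot \mathsf{Coh}\, \varepsilon \sim f\llbracket \theta \rrbracket)$. -}

{-# OPTIONS --without-K #-}
module Defs where

open import Level using (Level; _⊔_; suc)
open import Function using (id; _∘_)
open import Data.Product using (Σ; Σ-syntax; _×_; _,_)
open import Relation.Binary.PropositionalEquality
  using (_≡_; refl; sym; trans; cong)
open import Relation.Binary.PropositionalEquality.Properties
  using (trans-reflʳ; cong-id; cong-∘)

private
  variable
    a b : Level

_·_ : {X : Set a} {x y z : X} → x ≡ y → y ≡ z → x ≡ z
p · q = trans p q
infixr 5 _·_

ap : {X : Set a} {Y : Set b} (f : X → Y) {x y : X} → x ≡ y → f x ≡ f y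
ap = cong

ap2 : {X : Set a} {Y : Set b} (f : X → Y) {x y : X} {p q : x ≡ y} →
      p ≡ q → ap f p ≡ ap f q
ap2 f = cong (ap f)

_∼_ : {X : Set a} {P : X → Set b} (f g : (x : X) → P x) → Set (a ⊔ b)
f ∼ g = ∀ x → f x ≡ g x
infix 4 _∼_

nat : {X : Set a} {F : X → X} (H : F ∼ id) {x y : X} (p : x ≡ y) →
      H x · p ≡ ap F p · H y
nat H {x} refl = trans-reflʳ (H x)

rcancel : {X : Set a} {x y z : X} (u v : x ≡ y) (p : y ≡ z) →
          u · p ≡ v · p → u ≡ v
rcancel u v refl e = trans (sym (trans-reflʳ u)) (trans e (trans-reflʳ v))

-- naturality path H_{khx} = (kh)[H_x] followed by functoriality (kh)[H_x] = k[h[H_x]]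
Coh : {X : Set a} {Y : Set b} {h : X → Y} {k : Y → X} (H : (k ∘ h) ∼ id) →
      (λ x → H (k (h x))) ∼ (λ x → ap k (ap h (H x)))
Coh {h = h} {k = k} H x =
  rcancel (H (k (h x))) (ap (k ∘ h) (H x)) (H x) (nat H (H x))
  · cong-∘ (H x)

ishadj : {A : Set a} {B : Set b} (f : A → B) → Set (a ⊔ b)
ishadj {A = A} {B = B} f =
  Σ[ g ∈ (B → A) ] Σ[ η ∈ (g ∘ f) ∼ id ] Σ[ ε ∈ (f ∘ g) ∼ id ]
    ((λ x → ap f (η x)) ∼ (λ x → ε (f x)))

2adj : {A : Set a} {B : Set b} (f : A → B) → Set (a ⊔ b)
2adj {A = A} {B = B} f =
  Σ[ g ∈ (B → A) ] Σ[ η ∈ (g ∘ f) ∼ id ] Σ[ ε ∈ (f ∘ g) ∼ id ]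
  Σ[ τ ∈ ((λ x → ap f (η x)) ∼ (λ x → ε (f x))) ]
  Σ[ θ ∈ ((λ y → η (g y)) ∼ (λ y → ap g (ε y))) ]
    (((λ x → Coh {h = f} {k = g} η x · ap2 g (τ x)) ∼ (λ x → θ (f x)))
     × ((λ y → τ (g y) · Coh {h = g} {k = f} ε y) ∼ (λ y → ap2 f (θ y))))

_≃_ : (A : Set a) (B : Set b) → Set (a ⊔ b)
A ≃ B = Σ[ f ∈ (A → B) ] ishadj f
infix 4 _≃_

idEquiv : (A : Set a) → A ≃ A
idEquiv A = id , id , (λ x → refl) , (λ x → refl) , (λ x → refl)

idtoeqv : {A B : Set a} → A ≡ B → A ≃ B
idtoeqv {A = A} refl = idEquiv A

Univalence : (ℓ : Level) → Set (suc ℓ)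
Univalence ℓ = (A B : Set ℓ) → ishadj (idtoeqv {A = A} {B = B})

happly : {X : Set a} {P : X → Set b} {f g : (x : X) → P x} → f ≡ g → f ∼ g
happly refl x = refl

FunExt : (a b : Level) → Set (suc (a ⊔ b))
FunExt a b = {X : Set a} {P : X → Set b} (f g : (x : X) → P x) →
             ishadj (happly {f = f} {g = g})

{-# OPTIONS --without-K #-}
-- By univalence we may assume that (f , hf) is the identity equivalence.
-- For f = id the data of a 2-adjoint equivalence pairs up as (g , η), (ε , τ)
-- and (θ , first coherence): each pair is a function together with a homotopy
-- to or from a fixed function, hence by function extensionality ranges over a
-- contractible type whose centre is the trivial data.  Since Coh refl ≡ refl,
-- the second coherence evaluated there is exactly ∏ₓ (refl_refl ≡ refl_refl).
module Submission where

open import Defs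
open import Level using (Level)
open import Relation.Binary.PropositionalEquality using (_≡_; refl; subst)
open import Function using (id)
open import Function.Bundles using (_↔_; mk↔ₛ′)
open import Function.Properties.Inverse using (↔-refl; ↔-sym; ↔-trans)
open import Function.Properties.Inverse.HalfAdjointEquivalence as HAE using (↔⇒≃)
open import Data.Product using (Σ-syntax; _,_; proj₁)
open import Data.Product.Function.Dependent.Propositional using (Σ-↔)

private
  variable
    a b c : Level

↔⇒hadj : {X : Set a} {Y : Set b} → X ↔ Y → X ≃ Y
↔⇒hadj X↔Y = to , from , left-inverse-of , right-inverse-of , left-right
  where open HAE._≃_ (↔⇒≃ X↔Y)

ishadj⇒↔ : {X : Set a} {Y : Set b} {f : X → Y} → ishadj f → X ↔ Y
ishadj⇒↔ {f = f} (g , η , ε , _) = mk↔ₛ′ f g ε η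

Σ-singletonˡ : {X : Set a} {x₀ : X} {C : (x : X) → x ≡ x₀ → Set c} →
               (Σ[ x ∈ X ] Σ[ p ∈ x ≡ x₀ ] C x p) ↔ C x₀ refl
Σ-singletonˡ {x₀ = x₀} =
  mk↔ₛ′ (λ { (_ , refl , z) → z }) (λ z → x₀ , refl , z)
        (λ _ → refl) (λ { (_ , refl , _) → refl })

Σ-singletonʳ : {X : Set a} {x₀ : X} {C : (x : X) → x₀ ≡ x → Set c} →
               (Σ[ x ∈ X ] Σ[ p ∈ x₀ ≡ x ] C x p) ↔ C x₀ refl
Σ-singletonʳ {x₀ = x₀} =
  mk↔ₛ′ (λ { (_ , refl , z) → z }) (λ z → x₀ , refl , z)
        (λ _ → refl) (λ { (_ , refl , _) → refl })

module _ {ℓ : Level} (fe : FunExt ℓ ℓ) {X : Set ℓ} {P : X → Set ℓ} where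

  Σ-∼-singletonˡ : {f₀ : (x : X) → P x} {C : (f : (x : X) → P x) → f ∼ f₀ → Set c} →
                   (Σ[ f ∈ ((x : X) → P x) ] Σ[ H ∈ f ∼ f₀ ] C f H) ↔ C f₀ (λ _ → refl)
  Σ-∼-singletonˡ {f₀ = f₀} =
    ↔-trans (↔-sym (Σ-↔ ↔-refl (Σ-↔ (ishadj⇒↔ (fe _ f₀)) ↔-refl))) Σ-singletonˡ

  Σ-∼-singletonʳ : {f₀ : (x : X) → P x} {C : (f : (x : X) → P x) → f₀ ∼ f → Set c} →
                   (Σ[ f ∈ ((x : X) → P x) ] Σ[ H ∈ f₀ ∼ f ] C f H) ↔ C f₀ (λ _ → refl)
  Σ-∼-singletonʳ {f₀ = f₀} =
    ↔-trans (↔-sym (Σ-↔ ↔-refl (Σ-↔ (ishadj⇒↔ (fe f₀ _)) ↔-refl))) Σ-singletonʳ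

2adj-id↔ : {ℓ : Level} → FunExt ℓ ℓ → (A : Set ℓ) →
           2adj (id {A = A}) ↔ ((x : A) → refl {x = refl {x = x}} ≡ refl {x = refl {x = x}})
2adj-id↔ fe A = ↔-trans (Σ-∼-singletonˡ fe) (↔-trans (Σ-∼-singletonʳ fe) (Σ-∼-singletonʳ fe))

≃-induction : {ℓ : Level} → Univalence ℓ → {A : Set ℓ}
              (P : {B : Set ℓ} → A ≃ B → Set c) → P (idEquiv A) →
              {B : Set ℓ} (e : A ≃ B) → P e
≃-induction {ℓ = ℓ} ua {A} P P-id {B} e with ua A B
... | eqvtoid , _ , idtoeqv∘eqvtoid , _ =
  subst P (idtoeqv∘eqvtoid e) (P-idtoeqv (eqvtoid e))
  where
  P-idtoeqv : {C : Set ℓ} (p : A ≡ C) → P (idtoeqv p)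
  P-idtoeqv refl = P-id

theorem3p13 : {ℓ : Level} → Univalence ℓ → FunExt ℓ ℓ →
    {A B : Set ℓ} (f : A → B) → ishadj f →
    2adj f ≃ ((x : A) → refl {x = refl {x = x}} ≡ refl {x = refl {x = x}})
theorem3p13 ua fe {A} f hf =
  ≃-induction ua (λ e → 2adj (proj₁ e) ≃ _) (↔⇒hadj (2adj-id↔ fe A)) (f , hf)
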